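{- Let $f:\{0,1\}^n\to\{0,1\}$ be a symmetric Boolean function with exactly $3$ intervals, and suppose $f$ is not one of the two functions "$f(X)=1$ iff $|X|\in\{0,n\}$" and "$f(X)=0$ iff $|X|\in\{0,n\}$". Then every NN representation of $f$ with $3$ anchors is an interval-anchor assignment, i.e., its anchors can be indexed $a_1,a_2,a_3$ so that for each $i$, every $X$ with $|X|$ in the $i$-th interval satisfies $d(X,a_i)<d(X,a_k)$ for all $k\ne i$.
   Context: $|X|$ is the number of ones in $X$; $d$ is Euclidean distance. $f$ is symmetric if $f(X)$ depends only on $|X|$. The intervals of $f$ are the maximal sets of consecutive integers in $\{0,\dots,n\}$ on which $f$ (as a function of $|X|$) is constant, ordered increasingly. An NN representation of $f$ is a pair of disjoint finite sets $P,N\subset\mathbb{R}^n$ (anchors) such that for every $X$ with $f(X)=1$ there is $p\in P$ with $d(X,p)<d(X,q)$ for all $q\in N$, and for every $X$ with $f(X)=0$ there is $q\in N$ with $d(X,q)<d(X,p)$ for all $p\in P$. -}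

module Defs where

open import Level using (0ℓ)
open import Data.Nat using (ℕ; zero; suc) renaming (_+_ to _+ℕ_)
open import Data.Nat using (_≡ᵇ_)
open import Data.Bool using (Bool; true; false; if_then_else_; _xor_; _∨_)
open import Data.Fin using (Fin; toℕ) renaming (zero to fzero; suc to fsuc)
open import Data.Product using (Σ; ∃; _×_; _,_)
open import Data.Sum using (_⊎_)
open import Relation.Binary.PropositionalEquality using (_≡_; _≢_)
open import Relation.Nullary using (¬_)

-- An axiomatic model of the real numbers: a complete ordered field.
-- (Any two such structures are isomorphic, so quantifying over all of
-- them is the same as speaking about ℝ.)
record RealField : Set₁ where
  infixl 6 _+_
  infixl 7 _*_
  infix 4 _<_ _≤_
  field
    Carrier : Set
    0# 1# : Carrier
    _+_ _*_ : Carrier → Carrier → Carrier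
    -_ : Carrier → Carrier
    _<_ : Carrier → Carrier → Set
    +-assoc : ∀ x y z → (x + y) + z ≡ x + (y + z)
    +-comm : ∀ x y → x + y ≡ y + x
    +-identityˡ : ∀ x → 0# + x ≡ x
    +-inverseˡ : ∀ x → (- x) + x ≡ 0#
    *-assoc : ∀ x y z → (x * y) * z ≡ x * (y * z)
    *-comm : ∀ x y → x * y ≡ y * x
    *-identityˡ : ∀ x → 1# * x ≡ x
    distribˡ : ∀ x y z → x * (y + z) ≡ x * y + x * z
    0≢1 : 0# ≢ 1#
    *-inverse : ∀ x → x ≢ 0# → ∃ λ y → x * y ≡ 1#
    <-irrefl : ∀ x → ¬ (x < x)
    <-trans : ∀ {x y z} → x < y → y < z → x < z
    <-trichotomy : ∀ x y → x < y ⊎ x ≡ y ⊎ y < x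
    +-mono-< : ∀ {x y} z → x < y → x + z < y + z
    *-pos : ∀ {x y} → 0# < x → 0# < y → 0# < x * y

  _≤_ : Carrier → Carrier → Set
  x ≤ y = x < y ⊎ x ≡ y

  _-_ : Carrier → Carrier → Carrier
  x - y = x + (- y)

  field
    complete : (S : Carrier → Set) → ∃ S → (∃ λ u → ∀ x → S x → x ≤ u) →
               ∃ λ s → (∀ x → S x → x ≤ s) × (∀ u → (∀ x → S x → x ≤ u) → s ≤ u)

module _ (R : RealField) where
  open RealField R

  Point : ℕ → Set
  Point n = Fin n → Carrier

  bit : Bool → Carrier
  bit true = 1#
  bit false = 0#

  sumR : ∀ {n} → (Fin n → Carrier) → Carrier
  sumR {zero} v = 0#
  sumR {suc n} v = v fzero + sumR (λ i → v (fsuc i))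

  dist² : ∀ {n} → (Fin n → Bool) → Point n → Carrier
  dist² X p = sumR (λ i → (bit (X i) - p i) * (bit (X i) - p i))

  -- d(X,p) < d(X,q)  (equivalently on squared distances)
  Closer : ∀ {n} → (Fin n → Bool) → Point n → Point n → Set
  Closer X p q = dist² X p < dist² X q

  -- NN representation of f with exactly m anchors: anchors a (distinct
  -- points, so P ∪ N has m elements), label true = in P, false = in N.
  IsNNRep : ∀ {n m} → ((Fin n → Bool) → Bool) → (Fin m → Point n) → (Fin m → Bool) → Set
  IsNNRep {n} {m} f a lab =
    (∀ i j → a i ≡ a j → i ≡ j) ×
    (∀ X → ∃ λ i → lab i ≡ f X × (∀ j → lab j ≢ f X → Closer X (a i) (a j)))

weight : ∀ {n} → (Fin n → Bool) → ℕ
weight {zero} X = zero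
weight {suc n} X = (if X fzero then 1 else 0) +ℕ weight (λ i → X (fsuc i))

Symmetric : ∀ {n} → ((Fin n → Bool) → Bool) → Set
Symmetric {n} f = ∀ X Y → weight X ≡ weight Y → f X ≡ f Y

-- the input with ones exactly in the first k coordinates (weight min k n)
ones : ∀ {n} → ℕ → Fin n → Bool
ones k i = Data.Nat._<ᵇ_ (toℕ i) k

-- f viewed as a function of |X| (meaningful for symmetric f, k ≤ n)
onWeight : ∀ {n} → ((Fin n → Bool) → Bool) → ℕ → Bool
onWeight {n} f k = f (ones {n} k)

countBelow : (ℕ → Bool) → ℕ → ℕ
countBelow p zero = zero
countBelow p (suc k) = (if p k then 1 else 0) +ℕ countBelow p k

changeAt : ∀ {n} → ((Fin n → Bool) → Bool) → ℕ → Bool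
changeAt f j = onWeight f j xor onWeight f (suc j)

numIntervals : ∀ {n} → ((Fin n → Bool) → Bool) → ℕ
numIntervals {n} f = suc (countBelow (changeAt f) n)

-- 0-based index of the interval containing weight k (k ≤ n)
intervalIndex : ∀ {n} → ((Fin n → Bool) → Bool) → ℕ → ℕ
intervalIndex f k = countBelow (changeAt f) k

atEnds : ∀ {n} → (Fin n → Bool) → Bool
atEnds {n} X = (weight X ≡ᵇ 0) ∨ (weight X ≡ᵇ n)

{-# OPTIONS --safe #-}
module Submission where

-- Squared distance is a sum over coordinates, so exchanging some coordinates between two inputs X, Z
-- leaves d(X,p)² + d(Z,p)² unchanged for every anchor p. Hence if p beats q at both X and Z, it still
-- beats q at one of the two inputs after the exchange.
--
-- Write the intervals as [0,a], (a,b), [b,n], with f = v outside and f = ¬v inside. If only one anchor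
-- p carried the label v, its two opponents would both lose to p at ones a and at ones b; exchanges
-- then force, for each opponent, an input of weight a+1 where only the other one beats p, and one
-- more exchange produces an input of weight b where p loses. This needs room above b (or, after
-- complementing all inputs, below a), which exists unless f is one of the two excluded functions.
-- So exactly one anchor q has label ¬v, and it wins on the middle interval. A v-anchor cannot beat q
-- both below and above it: moving two such inputs towards each other one coordinate at a time keeps
-- a pair where it wins until they coincide. Hence the winner at weight 0 wins on the whole first
-- interval, and the winner at weight n on the whole last one.

open import Data.Bool using (Bool; true; false; not; if_then_else_; _xor_; _∨_; T)
open import Data.Bool.Properties using (T-≡; ¬-not; not-¬; not-involutive)
open import Data.Empty using (⊥; ⊥-elim)
open import Data.Fin using (Fin; toℕ; fromℕ<) renaming (zero to fzero; suc to fsuc)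
import Data.Fin.Properties as Fin
open import Data.Nat as ℕ using (ℕ; zero; suc)
import Data.Nat.Properties as ℕ
open import Data.Nat.GeneralisedArithmetic using (fold; fold-+)
open import Data.Product using (Σ; ∃; _×_; _,_; proj₁; proj₂)
open import Data.Sum using (_⊎_; inj₁; inj₂; [_,_]′)
open import Data.Vec.Functional using (updateAt; _∷_; [])
open import Data.Vec.Functional.Properties using (updateAt-updates; updateAt-minimal)
open import Function using (id; _∘_; const; Equivalence)
open import Relation.Binary using (tri<; tri≈; tri>)
open import Relation.Binary.PropositionalEquality
open import Relation.Nullary using (¬_; ¬?; Dec; yes; no)
open import Relation.Nullary.Decidable using (_×-dec_; decidable-stable)

open import Defs

infixl 6 _[_]≔_
_[_]≔_ : ∀ {n} → (Fin n → Bool) → Fin n → Bool → Fin n → Bool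
X [ c ]≔ β = updateAt X c (const β)

count : Bool → ℕ
count β = if β then 1 else 0

weight-[]≔ : ∀ {n} (X : Fin n → Bool) c β → weight (X [ c ]≔ β) ℕ.+ count (X c) ≡ weight X ℕ.+ count β
weight-[]≔ {suc n} X fzero β = begin
  (count β ℕ.+ w) ℕ.+ count (X fzero)  ≡⟨ ℕ.+-comm _ (count (X fzero)) ⟩
  count (X fzero) ℕ.+ (count β ℕ.+ w)  ≡⟨ cong (count (X fzero) ℕ.+_) (ℕ.+-comm (count β) w) ⟩
  count (X fzero) ℕ.+ (w ℕ.+ count β)  ≡⟨ ℕ.+-assoc (count (X fzero)) w (count β) ⟨
  (count (X fzero) ℕ.+ w) ℕ.+ count β  ∎
  where
  open ≡-Reasoning
  w = weight (λ i → X (fsuc i))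
weight-[]≔ {suc n} X (fsuc c) β = begin
  (count (X fzero) ℕ.+ weight (tail [ c ]≔ β)) ℕ.+ count (X (fsuc c))  ≡⟨ ℕ.+-assoc (count (X fzero)) _ _ ⟩
  count (X fzero) ℕ.+ (weight (tail [ c ]≔ β) ℕ.+ count (tail c))    ≡⟨ cong (count (X fzero) ℕ.+_) (weight-[]≔ tail c β) ⟩
  count (X fzero) ℕ.+ (weight tail ℕ.+ count β)                      ≡⟨ ℕ.+-assoc (count (X fzero)) _ _ ⟨
  (count (X fzero) ℕ.+ weight tail) ℕ.+ count β                      ∎
  where
  open ≡-Reasoning
  tail = λ i → X (fsuc i)

count≤1 : ∀ β → count β ℕ.≤ 1
count≤1 true = ℕ.≤-refl
count≤1 false = ℕ.z≤n

weight-[]≔-≤ : ∀ {n} (X : Fin n → Bool) c β → weight (X [ c ]≔ β) ℕ.≤ suc (weight X)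
weight-[]≔-≤ X c β = begin
  weight (X [ c ]≔ β)                    ≤⟨ ℕ.m≤m+n _ (count (X c)) ⟩
  weight (X [ c ]≔ β) ℕ.+ count (X c)    ≡⟨ weight-[]≔ X c β ⟩
  weight X ℕ.+ count β                   ≤⟨ ℕ.+-monoʳ-≤ (weight X) (count≤1 β) ⟩
  weight X ℕ.+ 1                         ≡⟨ ℕ.+-comm (weight X) 1 ⟩
  suc (weight X)                         ∎
  where open ℕ.≤-Reasoning

weight-≤-[]≔ : ∀ {n} (X : Fin n → Bool) c β → weight X ℕ.≤ suc (weight (X [ c ]≔ β))
weight-≤-[]≔ X c β = begin
  weight X                               ≤⟨ ℕ.m≤m+n _ (count β) ⟩
  weight X ℕ.+ count β                   ≡⟨ weight-[]≔ X c β ⟨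
  weight (X [ c ]≔ β) ℕ.+ count (X c)    ≤⟨ ℕ.+-monoʳ-≤ (weight (X [ c ]≔ β)) (count≤1 (X c)) ⟩
  weight (X [ c ]≔ β) ℕ.+ 1              ≡⟨ ℕ.+-comm _ 1 ⟩
  suc (weight (X [ c ]≔ β))              ∎
  where open ℕ.≤-Reasoning

weight-[]≔true : ∀ {n} (X : Fin n → Bool) c → X c ≡ false → weight (X [ c ]≔ true) ≡ suc (weight X)
weight-[]≔true X c Xc≡false = begin
  weight (X [ c ]≔ true)                      ≡⟨ ℕ.+-identityʳ _ ⟨
  weight (X [ c ]≔ true) ℕ.+ count false      ≡⟨ cong (λ β → weight (X [ c ]≔ true) ℕ.+ count β) Xc≡false ⟨
  weight (X [ c ]≔ true) ℕ.+ count (X c)      ≡⟨ weight-[]≔ X c true ⟩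
  weight X ℕ.+ 1                              ≡⟨ ℕ.+-comm (weight X) 1 ⟩
  suc (weight X)                              ∎
  where open ≡-Reasoning

weight-[]≔false : ∀ {n} (X : Fin n → Bool) c → X c ≡ true → suc (weight (X [ c ]≔ false)) ≡ weight X
weight-[]≔false X c Xc≡true = begin
  suc (weight (X [ c ]≔ false))               ≡⟨ ℕ.+-comm 1 _ ⟩
  weight (X [ c ]≔ false) ℕ.+ count true      ≡⟨ cong (λ β → weight (X [ c ]≔ false) ℕ.+ count β) Xc≡true ⟨
  weight (X [ c ]≔ false) ℕ.+ count (X c)     ≡⟨ weight-[]≔ X c false ⟩
  weight X ℕ.+ 0                              ≡⟨ ℕ.+-identityʳ _ ⟩
  weight X                                    ∎
  where open ≡-Reasoning

weight-≤ : ∀ {n} (X : Fin n → Bool) → weight X ℕ.≤ n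
weight-≤ {zero} X = ℕ.z≤n
weight-≤ {suc n} X = ℕ.+-mono-≤ (count≤1 (X fzero)) (weight-≤ (λ i → X (fsuc i)))

weight-resp-≗ : ∀ {n} {X Y : Fin n → Bool} → X ≗ Y → weight X ≡ weight Y
weight-resp-≗ {zero} X≗Y = refl
weight-resp-≗ {suc n} X≗Y = cong₂ ℕ._+_ (cong count (X≗Y fzero)) (weight-resp-≗ (X≗Y ∘ fsuc))

weight-not : ∀ {n} (X : Fin n → Bool) → weight (not ∘ X) ℕ.+ weight X ≡ n
weight-not {zero} X = refl
weight-not {suc n} X with X fzero
... | true = trans (ℕ.+-suc _ _) (cong suc (weight-not (X ∘ fsuc)))
... | false = cong suc (weight-not (X ∘ fsuc))

ones-true : ∀ {n m} {i : Fin n} → toℕ i ℕ.< m → ones m i ≡ true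
ones-true i<m = Equivalence.to T-≡ (ℕ.<⇒<ᵇ i<m)

ones-false : ∀ {n m} {i : Fin n} → m ℕ.≤ toℕ i → ones m i ≡ false
ones-false {i = i} m≤i = ¬-not λ eq → ℕ.≤⇒≯ m≤i (ℕ.<ᵇ⇒< (toℕ i) _ (Equivalence.from T-≡ eq))

weight-ones : ∀ {n} m → m ℕ.≤ n → weight (ones {n} m) ≡ m
weight-ones {suc n} zero ℕ.z≤n = weight-ones {n} zero ℕ.z≤n
weight-ones {zero} zero ℕ.z≤n = refl
weight-ones {suc n} (suc m) (ℕ.s≤s m≤n) = cong suc (weight-ones {n} m m≤n)

ones-suc : ∀ {n m} (c : Fin n) → toℕ c ≡ m → ones (suc m) ≗ ones m [ c ]≔ true
ones-suc {m = m} c c≡m i with ℕ.<-cmp (toℕ i) m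
... | tri< i<m _ _ = trans (ones-true (ℕ.m<n⇒m<1+n i<m))
                     (sym (trans (updateAt-minimal i c (ones m) (λ { refl → ℕ.<⇒≢ i<m c≡m })) (ones-true i<m)))
... | tri≈ _ i≡m _ rewrite Fin.toℕ-injective (trans i≡m (sym c≡m)) =
      trans (ones-true (ℕ.s≤s (ℕ.≤-reflexive c≡m))) (sym (updateAt-updates c (ones m)))
... | tri> _ _ m<i = trans (ones-false m<i)
                     (sym (trans (updateAt-minimal i c (ones m) (λ { refl → ℕ.>⇒≢ m<i c≡m })) (ones-false (ℕ.<⇒≤ m<i))))

-- Exchanging coordinates between two inputs

Swapped : ∀ {n} (X Z X′ Z′ : Fin n → Bool) → Set
Swapped X Z X′ Z′ = ∀ i → (X′ i ≡ X i × Z′ i ≡ Z i) ⊎ (X′ i ≡ Z i × Z′ i ≡ X i)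

swapped-at : ∀ {n} {X Z X′ Z′ : Fin n → Bool} c → X′ c ≡ Z c → Z′ c ≡ X c →
             (∀ i → i ≢ c → X′ i ≡ X i × Z′ i ≡ Z i) → Swapped X Z X′ Z′
swapped-at c X′c≡Zc Z′c≡Xc elsewhere i with i Fin.≟ c
... | yes refl = inj₂ (X′c≡Zc , Z′c≡Xc)
... | no i≢c = inj₁ (elsewhere i i≢c)

swap-coordinate : ∀ {n} (X Z : Fin n → Bool) c → Swapped X Z (X [ c ]≔ Z c) (Z [ c ]≔ X c)
swap-coordinate X Z c = swapped-at c (updateAt-updates c X) (updateAt-updates c Z)
  λ i i≢c → updateAt-minimal i c X i≢c , updateAt-minimal i c Z i≢c

swapped-not : ∀ {n} {X Z X′ Z′ : Fin n → Bool} → Swapped X Z X′ Z′ →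
              Swapped (not ∘ X) (not ∘ Z) (not ∘ X′) (not ∘ Z′)
swapped-not sw i with sw i
... | inj₁ (e₁ , e₂) = inj₁ (cong not e₁ , cong not e₂)
... | inj₂ (e₁ , e₂) = inj₂ (cong not e₁ , cong not e₂)

module RealFieldProperties (R : RealField) where
  open RealField R

  +-identityʳ : ∀ x → x + 0# ≡ x
  +-identityʳ x = trans (+-comm x 0#) (+-identityˡ x)

  x+z-z≡x : ∀ x z → (x + z) - z ≡ x
  x+z-z≡x x z = trans (+-assoc x z (- z))
    (trans (cong (x +_) (trans (+-comm z (- z)) (+-inverseˡ z))) (+-identityʳ x))

  +-cancelʳ-≡ : ∀ {x y} z → x + z ≡ y + z → x ≡ y
  +-cancelʳ-≡ {x} {y} z eq =
    trans (sym (x+z-z≡x x z)) (trans (cong (_- z) eq) (x+z-z≡x y z))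

  +-cancelʳ-< : ∀ {x y} z → x + z < y + z → x < y
  +-cancelʳ-< {x} {y} z lt = subst₂ _<_ (x+z-z≡x x z) (x+z-z≡x y z) (+-mono-< (- z) lt)

  +-monoʳ-< : ∀ {x y} z → x < y → z + x < z + y
  +-monoʳ-< {x} {y} z lt = subst₂ _<_ (+-comm x z) (+-comm y z) (+-mono-< z lt)

  +-monoʳ-≤ : ∀ {x y} z → x ≤ y → z + x ≤ z + y
  +-monoʳ-≤ z (inj₁ lt) = inj₁ (+-monoʳ-< z lt)
  +-monoʳ-≤ z (inj₂ refl) = inj₂ refl

  +-mono-<-< : ∀ {x y u v} → x < y → u < v → x + u < y + v
  +-mono-<-< {y = y} {u = u} x<y u<v = <-trans (+-mono-< u x<y) (+-monoʳ-< y u<v)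

  <-≤-trans : ∀ {x y z} → x < y → y ≤ z → x < z
  <-≤-trans x<y (inj₁ y<z) = <-trans x<y y<z
  <-≤-trans x<y (inj₂ refl) = x<y

  <-asym : ∀ {x y} → x < y → ¬ (y < x)
  <-asym {x} x<y y<x = <-irrefl x (<-trans x<y y<x)

  ≮⇒≥ : ∀ {x y} → ¬ (x < y) → y ≤ x
  ≮⇒≥ {x} {y} x≮y with <-trichotomy x y
  ... | inj₁ x<y = ⊥-elim (x≮y x<y)
  ... | inj₂ (inj₁ x≡y) = inj₂ (sym x≡y)
  ... | inj₂ (inj₂ y<x) = inj₁ y<x

  _<?_ : ∀ x y → Dec (x < y)
  x <? y with <-trichotomy x y
  ... | inj₁ x<y = yes x<y
  ... | inj₂ (inj₁ refl) = no (<-irrefl x)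
  ... | inj₂ (inj₂ y<x) = no (<-asym y<x)

  +-interchange : ∀ x y u v → (x + u) + (y + v) ≡ (x + y) + (u + v)
  +-interchange x y u v = begin
    (x + u) + (y + v)  ≡⟨ +-assoc x u (y + v) ⟩
    x + (u + (y + v))  ≡⟨ cong (x +_) (sym (+-assoc u y v)) ⟩
    x + ((u + y) + v)  ≡⟨ cong (λ t → x + (t + v)) (+-comm u y) ⟩
    x + ((y + u) + v)  ≡⟨ cong (x +_) (+-assoc y u v) ⟩
    x + (y + (u + v))  ≡⟨ sym (+-assoc x y (u + v)) ⟩
    (x + y) + (u + v)  ∎
    where open ≡-Reasoning

  SwapAdditive : ∀ {n} → ((Fin n → Bool) → Carrier) → Set
  SwapAdditive D = ∀ {X Z X′ Z′} → Swapped X Z X′ Z′ → D X′ + D Z′ ≡ D X + D Z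

  coordinatewise-swapAdditive : ∀ {n} (h : Fin n → Bool → Carrier) →
                                SwapAdditive (λ X → sumR R (λ i → h i (X i)))
  coordinatewise-swapAdditive {zero} h sw = refl
  coordinatewise-swapAdditive {suc n} h {X} {Z} {X′} {Z′} sw = begin
    (h₀ (X′ fzero) + S X′) + (h₀ (Z′ fzero) + S Z′)  ≡⟨ +-interchange _ _ _ _ ⟩
    (h₀ (X′ fzero) + h₀ (Z′ fzero)) + (S X′ + S Z′)  ≡⟨ cong₂ _+_ head (coordinatewise-swapAdditive (h ∘ fsuc) (sw ∘ fsuc)) ⟩
    (h₀ (X fzero) + h₀ (Z fzero)) + (S X + S Z)      ≡⟨ sym (+-interchange _ _ _ _) ⟩
    (h₀ (X fzero) + S X) + (h₀ (Z fzero) + S Z)      ∎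
    where
    open ≡-Reasoning
    h₀ = h fzero
    S : (Fin (suc n) → Bool) → Carrier
    S Y = sumR R (λ i → h (fsuc i) (Y (fsuc i)))
    head : h₀ (X′ fzero) + h₀ (Z′ fzero) ≡ h₀ (X fzero) + h₀ (Z fzero)
    head with sw fzero
    ... | inj₁ (x′≡x , z′≡z) rewrite x′≡x | z′≡z = refl
    ... | inj₂ (x′≡z , z′≡x) rewrite x′≡z | z′≡x = +-comm _ _

  dist²-swapAdditive : ∀ {n} (p : Point R n) → SwapAdditive (λ X → dist² R X p)
  dist²-swapAdditive p = coordinatewise-swapAdditive (λ i β → (bit R β - p i) * (bit R β - p i))

  swapAdditive-resp-≗ : ∀ {n} {D : (Fin n → Bool) → Carrier} → SwapAdditive D →
                        ∀ {X Y} → X ≗ Y → D X ≡ D Y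
  swapAdditive-resp-≗ {D = D} swD {X} {Y} X≗Y =
    sym (+-cancelʳ-≡ (D X) (swD {X} {X} {Y} {X} (λ i → inj₁ (sym (X≗Y i) , refl))))

  swap-preserves-< : ∀ {n} {D E : (Fin n → Bool) → Carrier} → SwapAdditive D → SwapAdditive E →
                     ∀ {X Z X′ Z′} → Swapped X Z X′ Z′ →
                     D X < E X → D Z < E Z → D X′ < E X′ ⊎ D Z′ < E Z′
  swap-preserves-< {D = D} {E} swD swE {X} {Z} {X′} {Z′} sw X< Z< with D Z′ <? E Z′
  ... | yes Z′< = inj₂ Z′<
  ... | no Z′≮ = inj₁ (+-cancelʳ-< (D Z′) (<-≤-trans sum< (+-monoʳ-≤ (E X′) (≮⇒≥ Z′≮))))
    where
    sum< : D X′ + D Z′ < E X′ + E Z′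
    sum< = subst₂ _<_ (sym (swD sw)) (sym (swE sw)) (+-mono-<-< X< Z<)

-- Arguments on a band of weights

module BandArguments (R : RealField) where
  open RealField R
  open RealFieldProperties R

  module _ {n} {D E : (Fin n → Bool) → Carrier} (swD : SwapAdditive D) (swE : SwapAdditive E)
           {a b : ℕ} (a+2≤b : 2 ℕ.+ a ℕ.≤ b)
           (E<D-inside : ∀ S → a ℕ.< weight S → weight S ℕ.< b → E S < D S) where

    private
      stays-below : ∀ Y → weight Y ℕ.≤ suc a → D Y < E Y → weight Y ℕ.≤ a
      stays-below Y Y≤1+a D<E with ℕ.m≤n⇒m<n∨m≡n Y≤1+a
      ... | inj₁ Y<1+a = ℕ.≤-pred Y<1+a
      ... | inj₂ Y≡1+a = ⊥-elim (<-asym D<E (E<D-inside Y (ℕ.≤-reflexive (sym Y≡1+a))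
                                                           (ℕ.<-≤-trans (ℕ.≤-reflexive (cong suc Y≡1+a)) a+2≤b)))

      stays-above : ∀ Y → b ℕ.≤ suc (weight Y) → D Y < E Y → b ℕ.≤ weight Y
      stays-above Y b≤1+Y D<E with ℕ.m≤n⇒m<n∨m≡n b≤1+Y
      ... | inj₁ b<1+Y = ℕ.≤-pred b<1+Y
      ... | inj₂ b≡1+Y = ⊥-elim (<-asym D<E (E<D-inside Y (ℕ.≤-pred (ℕ.≤-trans a+2≤b (ℕ.≤-reflexive b≡1+Y)))
                                                           (ℕ.≤-reflexive (sym b≡1+Y))))

      Agree : ℕ → (Fin n → Bool) → (Fin n → Bool) → Set
      Agree k X Z = ∀ i → toℕ i ℕ.< k → X i ≡ Z i

      agree-step : ∀ {k X Z} c → toℕ c ≡ k → Agree k X Z → Agree (suc k) (X [ c ]≔ Z c) Z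
      agree-step {k} {X} {Z} c c≡k agree i i<1+k with ℕ.m≤n⇒m<n∨m≡n (ℕ.≤-pred i<1+k)
      ... | inj₁ i<k = trans (updateAt-minimal i c X λ { refl → ℕ.<⇒≢ i<k c≡k }) (agree i i<k)
      ... | inj₂ i≡k rewrite Fin.toℕ-injective (trans i≡k (sym c≡k)) = updateAt-updates c X

      -- X and Z are made to agree on one more coordinate at each step, by the swap that keeps D < E.
      walk : ∀ m k {X Z} → m ℕ.+ k ≡ n → Agree k X Z → weight X ℕ.≤ a → b ℕ.≤ weight Z →
             D X < E X → D Z < E Z → ⊥
      walk zero k {X} {Z} k≡n agree X≤a b≤Z _ _ = ℕ.<⇒≱ (ℕ.≤-trans (ℕ.n≤1+n _) a+2≤b) (begin
        b         ≤⟨ b≤Z ⟩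
        weight Z  ≡⟨ weight-resp-≗ (λ i → agree i (subst (toℕ i ℕ.<_) (sym k≡n) (Fin.toℕ<n i))) ⟨
        weight X  ≤⟨ X≤a ⟩
        a         ∎)
        where open ℕ.≤-Reasoning
      walk (suc m) k {X} {Z} 1+m+k≡n agree X≤a b≤Z DX<EX DZ<EZ =
        continue (swap-preserves-< swD swE (swap-coordinate X Z c) DX<EX DZ<EZ)
        where
        k<n : k ℕ.< n
        k<n = subst (k ℕ.<_) 1+m+k≡n (ℕ.s≤s (ℕ.m≤n+m k m))
        c : Fin n
        c = fromℕ< k<n
        c≡k : toℕ c ≡ k
        c≡k = Fin.toℕ-fromℕ< k<n
        m+1+k≡n : m ℕ.+ suc k ≡ n
        m+1+k≡n = trans (ℕ.+-suc m k) 1+m+k≡n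
        continue : D (X [ c ]≔ Z c) < E (X [ c ]≔ Z c) ⊎ D (Z [ c ]≔ X c) < E (Z [ c ]≔ X c) → ⊥
        continue (inj₁ DX′<EX′) =
          walk m (suc k) m+1+k≡n (agree-step c c≡k agree)
               (stays-below _ (ℕ.≤-trans (weight-[]≔-≤ X c (Z c)) (ℕ.s≤s X≤a)) DX′<EX′) b≤Z DX′<EX′ DZ<EZ
        continue (inj₂ DZ′<EZ′) =
          walk m (suc k) m+1+k≡n (λ i i<1+k → sym (agree-step c c≡k (λ j j<k → sym (agree j j<k)) i i<1+k))
               X≤a (stays-above _ (ℕ.≤-trans b≤Z (weight-≤-[]≔ Z c (X c))) DZ′<EZ′) DX<EX DZ′<EZ′

    ¬-below-and-above-band : ∀ {X Z} → weight X ℕ.≤ a → b ℕ.≤ weight Z → D X < E X → D Z < E Z → ⊥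
    ¬-below-and-above-band = walk n 0 (ℕ.+-identityʳ n) (λ _ ())

  module _ {n} {D E₁ E₂ : (Fin n → Bool) → Carrier}
           (swD : SwapAdditive D) (swE₁ : SwapAdditive E₁) (swE₂ : SwapAdditive E₂)
           {a b : ℕ} (a+2≤b : 2 ℕ.+ a ℕ.≤ b) (b<n : b ℕ.< n)
           (D<E-outside : ∀ S → weight S ℕ.≤ a ⊎ b ℕ.≤ weight S → D S < E₁ S × D S < E₂ S)
           (E<D-inside : ∀ S → a ℕ.< weight S → weight S ℕ.< b → E₁ S < D S ⊎ E₂ S < D S) where

    private
      a<b : a ℕ.< b
      a<b = ℕ.≤-trans (ℕ.n≤1+n _) a+2≤b

      a≤n : a ℕ.≤ n
      a≤n = ℕ.<⇒≤ (ℕ.<-trans a<b b<n)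

      raised : Fin n → Fin n → Bool
      raised c = ones a [ c ]≔ true

      ones-a-below : weight (ones {n} a) ℕ.≤ a
      ones-a-below = ℕ.≤-reflexive (weight-ones a a≤n)

      weight-raised : ∀ c → a ℕ.≤ toℕ c → weight (raised c) ≡ suc a
      weight-raised c a≤c = trans (weight-[]≔true (ones a) c (ones-false a≤c)) (cong suc (weight-ones a a≤n))

      module OneOpponent {E : (Fin n → Bool) → Carrier} (swE : SwapAdditive E)
                         (D<E-outside : ∀ S → weight S ℕ.≤ a ⊎ b ℕ.≤ weight S → D S < E S) where

        E<D-resp-≗ : ∀ {X Y} → X ≗ Y → E Y < D Y → E X < D X
        E<D-resp-≗ X≗Y = subst₂ _<_ (swapAdditive-resp-≗ swE (λ i → sym (X≗Y i)))
                                    (swapAdditive-resp-≗ swD (λ i → sym (X≗Y i)))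

        -- Exchanging coordinate c turns raised c into ones a, where D < E, so E < D survives in the other input.
        raise : ∀ {T} c → a ℕ.≤ toℕ c → T c ≡ false → E T < D T → E (raised c) < D (raised c) →
                E (T [ c ]≔ true) < D (T [ c ]≔ true)
        raise {T} c a≤c Tc≡false E<D-T E<D-raised =
          [ id , (λ E<D → ⊥-elim (<-asym E<D (D<E-outside (ones a) (inj₁ ones-a-below)))) ]′
            (swap-preserves-< swE swD swapped E<D-T E<D-raised)
          where
          swapped : Swapped T (raised c) (T [ c ]≔ true) (ones a)
          swapped = swapped-at c (trans (updateAt-updates c T) (sym (updateAt-updates c (ones a))))
                                 (trans (ones-false a≤c) (sym Tc≡false))
                                 λ i i≢c → updateAt-minimal i c T i≢c , sym (updateAt-minimal i c (ones a) i≢c)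

        blocked : ∀ {T} c → a ℕ.≤ toℕ c → T c ≡ false → suc (weight T) ≡ b →
                  E T < D T → E (raised c) < D (raised c) → ⊥
        blocked {T} c a≤c Tc≡false 1+T≡b E<D-T E<D-raised =
          <-asym (raise c a≤c Tc≡false E<D-T E<D-raised)
                 (D<E-outside _ (inj₂ (ℕ.≤-reflexive (sym (trans (weight-[]≔true T c Tc≡false) 1+T≡b)))))

        climb : (∀ c → a ℕ.≤ toℕ c → toℕ c ℕ.< b → E (raised c) < D (raised c)) →
                ∀ m → a ℕ.< m → m ℕ.≤ b → E (ones m) < D (ones m)
        climb E<D-raised (suc m) a<1+m 1+m≤b = E<D-resp-≗ (ones-suc c c≡m) E<D-step
          where
          m<n : m ℕ.< n
          m<n = ℕ.<-≤-trans 1+m≤b (ℕ.<⇒≤ b<n)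
          c : Fin n
          c = fromℕ< m<n
          c≡m : toℕ c ≡ m
          c≡m = Fin.toℕ-fromℕ< m<n
          a≤c : a ℕ.≤ toℕ c
          a≤c = subst (a ℕ.≤_) (sym c≡m) (ℕ.≤-pred a<1+m)
          c<b : toℕ c ℕ.< b
          c<b = subst (ℕ._< b) (sym c≡m) 1+m≤b
          E<D-step : E (ones m [ c ]≔ true) < D (ones m [ c ]≔ true)
          E<D-step with ℕ.m≤n⇒m<n∨m≡n (ℕ.≤-pred a<1+m)
          ... | inj₁ a<m = raise c a≤c (ones-false (ℕ.≤-reflexive (sym c≡m)))
                                 (climb E<D-raised m a<m (ℕ.<⇒≤ 1+m≤b)) (E<D-raised c a≤c c<b)
          ... | inj₂ refl = E<D-raised c a≤c c<b

        -- Otherwise climb would reach ones b, where D < E.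
        stuck : ∃ λ c → a ℕ.≤ toℕ c × toℕ c ℕ.< b × ¬ (E (raised c) < D (raised c))
        stuck with Fin.any? (λ c → a ℕ.≤? toℕ c ×-dec toℕ c ℕ.<? b ×-dec ¬? (E (raised c) <? D (raised c)))
        ... | yes found = found
        ... | no ¬found = ⊥-elim (<-asym (climb E<D-raised b a<b ℕ.≤-refl)
                                         (D<E-outside (ones b) (inj₂ (ℕ.≤-reflexive (sym (weight-ones b (ℕ.<⇒≤ b<n)))))))
          where
          E<D-raised : ∀ c → a ℕ.≤ toℕ c → toℕ c ℕ.< b → E (raised c) < D (raised c)
          E<D-raised c a≤c c<b = decidable-stable (E (raised c) <? D (raised c)) λ ≮ → ¬found (c , a≤c , c<b , ≮)

    one-versus-two-below-top : ⊥
    one-versus-two-below-top = conclude O₁.stuck O₂.stuck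
      where
      module O₁ = OneOpponent swE₁ (λ S → proj₁ ∘ D<E-outside S)
      module O₂ = OneOpponent swE₂ (λ S → proj₂ ∘ D<E-outside S)

      inside-raised : ∀ c → a ℕ.≤ toℕ c → E₁ (raised c) < D (raised c) ⊎ E₂ (raised c) < D (raised c)
      inside-raised c a≤c = E<D-inside (raised c) (ℕ.≤-reflexive (sym (weight-raised c a≤c)))
                                                  (ℕ.<-≤-trans (ℕ.≤-reflexive (cong suc (weight-raised c a≤c))) a+2≤b)

      conclude : ∃ (λ c → a ℕ.≤ toℕ c × toℕ c ℕ.< b × ¬ (E₁ (raised c) < D (raised c))) →
                 ∃ (λ c → a ℕ.≤ toℕ c × toℕ c ℕ.< b × ¬ (E₂ (raised c) < D (raised c))) → ⊥
      conclude (c₁ , a≤c₁ , c₁<b , E₁≮D) (c₂ , a≤c₂ , c₂<b , E₂≮D) =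
        [ (λ E₁<D → O₁.blocked c₂ a≤c₂ Vc₂≡false 1+V≡b E₁<D E₁<D-c₂) ,
          (λ E₂<D → O₂.blocked c₁ a≤c₁ Vc₁≡false 1+V≡b E₂<D E₂<D-c₁) ]′
          (E<D-inside V (ℕ.≤-pred (ℕ.≤-trans a+2≤b (ℕ.≤-reflexive (sym 1+V≡b)))) (ℕ.≤-reflexive 1+V≡b))
        where
        E₂<D-c₁ : E₂ (raised c₁) < D (raised c₁)
        E₂<D-c₁ = [ (λ E₁<D → ⊥-elim (E₁≮D E₁<D)) , id ]′ (inside-raised c₁ a≤c₁)
        E₁<D-c₂ : E₁ (raised c₂) < D (raised c₂)
        E₁<D-c₂ = [ id , (λ E₂<D → ⊥-elim (E₂≮D E₂<D)) ]′ (inside-raised c₂ a≤c₂)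
        c₂≢c₁ : c₂ ≢ c₁
        c₂≢c₁ refl = E₁≮D E₁<D-c₂
        U V : Fin n → Bool
        U = ones (suc b) [ c₁ ]≔ false
        V = U [ c₂ ]≔ false
        Uc₂≡true : U c₂ ≡ true
        Uc₂≡true = trans (updateAt-minimal c₂ c₁ (ones (suc b)) c₂≢c₁) (ones-true (ℕ.m<n⇒m<1+n c₂<b))
        1+V≡b : suc (weight V) ≡ b
        1+V≡b = begin
          suc (weight V)  ≡⟨ weight-[]≔false U c₂ Uc₂≡true ⟩
          weight U        ≡⟨ ℕ.suc-injective (trans (weight-[]≔false (ones (suc b)) c₁ (ones-true (ℕ.m<n⇒m<1+n c₁<b)))
                                                    (weight-ones (suc b) b<n)) ⟩
          b               ∎
          where open ≡-Reasoning
        Vc₂≡false : V c₂ ≡ false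
        Vc₂≡false = updateAt-updates c₂ U
        Vc₁≡false : V c₁ ≡ false
        Vc₁≡false = trans (updateAt-minimal c₁ c₂ U (c₂≢c₁ ∘ sym)) (updateAt-updates c₁ (ones (suc b)))

  -- Complementing all inputs preserves the hypotheses and reflects weights, w ↦ n − w.
  one-versus-two-impossible :
    ∀ {n} {D E₁ E₂ : (Fin n → Bool) → Carrier} →
    SwapAdditive D → SwapAdditive E₁ → SwapAdditive E₂ →
    ∀ {a b} → 2 ℕ.+ a ℕ.≤ b → b ℕ.≤ n → 0 ℕ.< a ⊎ b ℕ.< n →
    (∀ S → weight S ℕ.≤ a ⊎ b ℕ.≤ weight S → D S < E₁ S × D S < E₂ S) →
    (∀ S → a ℕ.< weight S → weight S ℕ.< b → E₁ S < D S ⊎ E₂ S < D S) → ⊥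
  one-versus-two-impossible swD swE₁ swE₂ a+2≤b b≤n (inj₂ b<n) outside inside =
    one-versus-two-below-top swD swE₁ swE₂ a+2≤b b<n outside inside
  one-versus-two-impossible {n} {D} {E₁} {E₂} swD swE₁ swE₂ {a} {b} a+2≤b b≤n (inj₁ 0<a) outside inside
    with ℕ.m≤n⇒m<n∨m≡n b≤n
  ... | inj₁ b<n = one-versus-two-below-top swD swE₁ swE₂ a+2≤b b<n outside inside
  ... | inj₂ refl =
    one-versus-two-below-top (swD ∘ swapped-not) (swE₁ ∘ swapped-not) (swE₂ ∘ swapped-not)
      {a = 0} {b = b′} 2≤b′ b′<n outside′ inside′
    where
    b′ : ℕ
    b′ = n ℕ.∸ a
    b′+a≡n : b′ ℕ.+ a ≡ n
    b′+a≡n = ℕ.m∸n+n≡m (ℕ.≤-trans (ℕ.m≤n+m a 2) a+2≤b)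
    2≤b′ : 2 ℕ.≤ b′
    2≤b′ = ℕ.+-cancelʳ-≤ a 2 b′ (ℕ.≤-trans a+2≤b (ℕ.≤-reflexive (sym b′+a≡n)))
    b′<n : b′ ℕ.< n
    b′<n = subst (b′ ℕ.<_) b′+a≡n (ℕ.m<m+n b′ 0<a)
    outside′ : ∀ S → weight S ℕ.≤ 0 ⊎ b′ ℕ.≤ weight S →
               D (not ∘ S) < E₁ (not ∘ S) × D (not ∘ S) < E₂ (not ∘ S)
    outside′ S (inj₁ S≤0) = outside (not ∘ S) (inj₂ (ℕ.≤-reflexive (begin
      n                              ≡⟨ weight-not S ⟨
      weight (not ∘ S) ℕ.+ weight S  ≡⟨ cong (weight (not ∘ S) ℕ.+_) (ℕ.n≤0⇒n≡0 S≤0) ⟩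
      weight (not ∘ S) ℕ.+ 0         ≡⟨ ℕ.+-identityʳ _ ⟩
      weight (not ∘ S)               ∎)))
      where open ≡-Reasoning
    outside′ S (inj₂ b′≤S) = outside (not ∘ S) (inj₁ (ℕ.+-cancelʳ-≤ b′ (weight (not ∘ S)) a (begin
      weight (not ∘ S) ℕ.+ b′        ≤⟨ ℕ.+-monoʳ-≤ (weight (not ∘ S)) b′≤S ⟩
      weight (not ∘ S) ℕ.+ weight S  ≡⟨ weight-not S ⟩
      n                              ≡⟨ b′+a≡n ⟨
      b′ ℕ.+ a                       ≡⟨ ℕ.+-comm b′ a ⟩
      a ℕ.+ b′                       ∎)))
      where open ℕ.≤-Reasoning
    inside′ : ∀ S → 0 ℕ.< weight S → weight S ℕ.< b′ →
              E₁ (not ∘ S) < D (not ∘ S) ⊎ E₂ (not ∘ S) < D (not ∘ S)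
    inside′ S 0<S S<b′ = inside (not ∘ S)
      (ℕ.+-cancelʳ-< (weight S) a (weight (not ∘ S)) (begin-strict
        a ℕ.+ weight S                 <⟨ ℕ.+-monoʳ-< a S<b′ ⟩
        a ℕ.+ b′                       ≡⟨ ℕ.+-comm a b′ ⟩
        b′ ℕ.+ a                       ≡⟨ b′+a≡n ⟩
        n                              ≡⟨ weight-not S ⟨
        weight (not ∘ S) ℕ.+ weight S  ∎))
      (subst (weight (not ∘ S) ℕ.<_) (weight-not S) (ℕ.m<m+n (weight (not ∘ S)) 0<S))
      where open ℕ.≤-Reasoning

-- Symmetric functions with three intervals

countBelow-suc-≤ : ∀ (g : ℕ → Bool) k → countBelow g (suc k) ℕ.≤ suc (countBelow g k)
countBelow-suc-≤ g k = ℕ.+-monoˡ-≤ (countBelow g k) (count≤1 (g k))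

countBelow-mono : ∀ (g : ℕ → Bool) {k k′} → k ℕ.≤ k′ → countBelow g k ℕ.≤ countBelow g k′
countBelow-mono g {k′ = zero} ℕ.z≤n = ℕ.≤-refl
countBelow-mono g {k} {suc k′} k≤1+k′ with ℕ.m≤n⇒m<n∨m≡n k≤1+k′
... | inj₁ k<1+k′ = ℕ.≤-trans (countBelow-mono g (ℕ.≤-pred k<1+k′)) (ℕ.m≤n+m _ (count (g k′)))
... | inj₂ refl = ℕ.≤-refl

countBelow-crossing : ∀ (g : ℕ → Bool) {t} k → t ℕ.< countBelow g k →
                      ∃ λ j → j ℕ.< k × countBelow g j ≡ t × countBelow g (suc j) ≡ suc t
countBelow-crossing g {t} (suc k) t<c with t ℕ.<? countBelow g k
... | yes t<ck = let j , j<k , eq₁ , eq₂ = countBelow-crossing g k t<ck in j , ℕ.m<n⇒m<1+n j<k , eq₁ , eq₂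
... | no t≮ck = k , ℕ.≤-refl , ck≡t ,
                ℕ.≤-antisym (ℕ.≤-trans (countBelow-suc-≤ g k) (ℕ.s≤s (ℕ.≤-reflexive ck≡t))) t<c
  where
  ck≡t : countBelow g k ≡ t
  ck≡t = ℕ.≤-antisym (ℕ.≮⇒≥ t≮ck) (ℕ.≤-pred (ℕ.≤-trans t<c (countBelow-suc-≤ g k)))

flip-by-xor : ∀ x y → y ≡ fold x not (count (x xor y))
flip-by-xor true true = refl
flip-by-xor true false = refl
flip-by-xor false true = refl
flip-by-xor false false = refl

value-by-changes : ∀ (h : ℕ → Bool) k → h k ≡ fold (h 0) not (countBelow (λ j → h j xor h (suc j)) k)
value-by-changes h zero = refl
value-by-changes h (suc k) = begin
  h (suc k)                             ≡⟨ flip-by-xor (h k) (h (suc k)) ⟩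
  fold (h k) not (count changed)        ≡⟨ cong (λ z → fold z not (count changed)) (value-by-changes h k) ⟩
  fold (fold (h 0) not changes) not (count changed)  ≡⟨ fold-+ (h 0) not (count changed) ⟨
  fold (h 0) not (count changed ℕ.+ changes)         ∎
  where
  open ≡-Reasoning
  changed = h k xor h (suc k)
  changes = countBelow (λ j → h j xor h (suc j)) k

Interval : ℕ → ℕ → Fin 3 → ℕ → Set
Interval a b fzero w = w ℕ.≤ a
Interval a b (fsuc fzero) w = a ℕ.< w × w ℕ.< b
Interval a b (fsuc (fsuc fzero)) w = b ℕ.≤ w

record ThreeIntervals {n} (f : (Fin n → Bool) → Bool) : Set where
  field
    a b : ℕ
    v : Bool
    a+2≤b : 2 ℕ.+ a ℕ.≤ b
    b≤n : b ℕ.≤ n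
    f-below : ∀ X → weight X ℕ.≤ a → f X ≡ v
    f-inside : ∀ X → a ℕ.< weight X → weight X ℕ.< b → f X ≡ not v
    f-above : ∀ X → b ℕ.≤ weight X → f X ≡ v
    interval : ∀ (X : Fin n → Bool) i → toℕ i ≡ intervalIndex f (weight X) → Interval a b i (weight X)

three-intervals : ∀ {n} {f : (Fin n → Bool) → Bool} → Symmetric f → numIntervals f ≡ 3 → ThreeIntervals f
three-intervals {n} {f} symmetric three = record
  { a = a ; b = suc b′ ; v = onWeight f 0 ; a+2≤b = ℕ.s≤s a<b′ ; b≤n = b′<n
  ; f-below = λ X X≤a → value X 0 (ℕ.n≤0⇒n≡0 (index-≤0 X≤a))
  ; f-inside = λ X a<X X<b → value X 1 (ℕ.≤-antisym (index-≤1 X<b) (index-≥1 a<X))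
  ; f-above = λ X b≤X →
      trans (value X 2 (ℕ.≤-antisym (index-≤2 (weight-≤ X)) (index-≥2 b≤X))) (not-involutive _)
  ; interval = interval
  }
  where
  index = intervalIndex f
  index-n≡2 : index n ≡ 2
  index-n≡2 = ℕ.suc-injective three
  first = countBelow-crossing (changeAt f) {0} n (subst (0 ℕ.<_) (sym index-n≡2) (ℕ.s≤s ℕ.z≤n))
  second = countBelow-crossing (changeAt f) {1} n (subst (1 ℕ.<_) (sym index-n≡2) ℕ.≤-refl)
  a b′ : ℕ
  a = proj₁ first
  b′ = proj₁ second
  b′<n : b′ ℕ.< n
  b′<n = proj₁ (proj₂ second)
  index-a≡0 : index a ≡ 0
  index-a≡0 = proj₁ (proj₂ (proj₂ first))
  index-1+a≡1 : index (suc a) ≡ 1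
  index-1+a≡1 = proj₂ (proj₂ (proj₂ first))
  index-b′≡1 : index b′ ≡ 1
  index-b′≡1 = proj₁ (proj₂ (proj₂ second))
  index-1+b′≡2 : index (suc b′) ≡ 2
  index-1+b′≡2 = proj₂ (proj₂ (proj₂ second))

  index-≤0 : ∀ {k} → k ℕ.≤ a → index k ℕ.≤ 0
  index-≤0 k≤a = ℕ.≤-trans (countBelow-mono _ k≤a) (ℕ.≤-reflexive index-a≡0)
  index-≥1 : ∀ {k} → a ℕ.< k → 1 ℕ.≤ index k
  index-≥1 a<k = ℕ.≤-trans (ℕ.≤-reflexive (sym index-1+a≡1)) (countBelow-mono _ a<k)
  index-≤1 : ∀ {k} → k ℕ.< suc b′ → index k ℕ.≤ 1
  index-≤1 k<b = ℕ.≤-trans (countBelow-mono _ (ℕ.≤-pred k<b)) (ℕ.≤-reflexive index-b′≡1)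
  index-≥2 : ∀ {k} → suc b′ ℕ.≤ k → 2 ℕ.≤ index k
  index-≥2 b≤k = ℕ.≤-trans (ℕ.≤-reflexive (sym index-1+b′≡2)) (countBelow-mono _ b≤k)
  index-≤2 : ∀ {k} → k ℕ.≤ n → index k ℕ.≤ 2
  index-≤2 k≤n = ℕ.≤-trans (countBelow-mono _ k≤n) (ℕ.≤-reflexive index-n≡2)

  a<b′ : a ℕ.< b′
  a<b′ = ℕ.≰⇒> λ b′≤a → ℕ.<⇒≱ (ℕ.≤-reflexive (sym index-b′≡1)) (index-≤0 b′≤a)

  value : ∀ X t → index (weight X) ≡ t → f X ≡ fold (onWeight f 0) not t
  value X t index≡t = begin
    f X                                      ≡⟨ symmetric X (ones (weight X)) (sym (weight-ones (weight X) (weight-≤ X))) ⟩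
    onWeight f (weight X)                    ≡⟨ value-by-changes (onWeight f) (weight X) ⟩
    fold (onWeight f 0) not (index (weight X))  ≡⟨ cong (fold (onWeight f 0) not) index≡t ⟩
    fold (onWeight f 0) not t                ∎
    where open ≡-Reasoning

  interval : ∀ (X : Fin n → Bool) i → toℕ i ≡ index (weight X) → Interval a (suc b′) i (weight X)
  interval X fzero 0≡index = ℕ.≮⇒≥ λ a<X → ℕ.<⇒≱ (index-≥1 a<X) (ℕ.≤-reflexive (sym 0≡index))
  interval X (fsuc fzero) 1≡index =
    ℕ.≰⇒> (λ X≤a → ℕ.<⇒≱ (ℕ.≤-reflexive 1≡index) (index-≤0 X≤a)) ,
    ℕ.≰⇒> (λ b≤X → ℕ.<⇒≱ (index-≥2 b≤X) (ℕ.≤-reflexive (sym 1≡index)))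
  interval X (fsuc (fsuc fzero)) 2≡index = ℕ.≮⇒≥ λ X<b → ℕ.<⇒≱ (ℕ.≤-reflexive 2≡index) (index-≤1 X<b)

module _ {n} {f : (Fin n → Bool) → Bool} (I : ThreeIntervals f) where
  open ThreeIntervals I

  f-by-ends : a ≡ 0 → b ≡ n → ∀ X → f X ≡ (if atEnds X then v else not v)
  f-by-ends a≡0 b≡n X = go (weight X ℕ.≡ᵇ 0) (weight X ℕ.≡ᵇ n) refl refl
    where
    go : ∀ e₀ eₙ → (weight X ℕ.≡ᵇ 0) ≡ e₀ → (weight X ℕ.≡ᵇ n) ≡ eₙ → f X ≡ (if e₀ ∨ eₙ then v else not v)
    go true _ e₀ _ = f-below X (ℕ.≤-reflexive (trans (ℕ.≡ᵇ⇒≡ _ 0 (Equivalence.from T-≡ e₀)) (sym a≡0)))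
    go false true _ eₙ = f-above X (ℕ.≤-reflexive (trans b≡n (sym (ℕ.≡ᵇ⇒≡ _ n (Equivalence.from T-≡ eₙ)))))
    go false false e₀ eₙ = f-inside X
      (subst (ℕ._< weight X) (sym a≡0) (ℕ.n≢0⇒n>0 λ X≡0 → subst T e₀ (ℕ.≡⇒≡ᵇ _ 0 X≡0)))
      (subst (weight X ℕ.<_) (sym b≡n) (ℕ.≤∧≢⇒< (weight-≤ X) λ X≡n → subst T eₙ (ℕ.≡⇒≡ᵇ _ n X≡n)))

  cut-points-not-extreme : ¬ (∀ X → f X ≡ atEnds X) → ¬ (∀ X → f X ≡ not (atEnds X)) → 0 ℕ.< a ⊎ b ℕ.< n
  cut-points-not-extreme ¬ends ¬co-ends with a ℕ.≟ 0 | b ℕ.<? n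
  ... | no a≢0 | _ = inj₁ (ℕ.n≢0⇒n>0 a≢0)
  ... | yes _ | yes b<n = inj₂ b<n
  ... | yes a≡0 | no b≮n = ⊥-elim (by-v v refl)
    where
    f≡ = f-by-ends a≡0 (ℕ.≤-antisym b≤n (ℕ.≮⇒≥ b≮n))
    by-v : ∀ β → v ≡ β → ⊥
    by-v true v≡true = ¬ends λ X → trans (f≡ X) (if-v-true (atEnds X))
      where
      if-v-true : ∀ e → (if e then v else not v) ≡ e
      if-v-true true = v≡true
      if-v-true false = cong not v≡true
    by-v false v≡false = ¬co-ends λ X → trans (f≡ X) (if-v-false (atEnds X))
      where
      if-v-false : ∀ e → (if e then v else not v) ≡ not e
      if-v-false true = v≡false
      if-v-false false = cong not v≡false

-- Three anchors

Fin3-cover : ∀ {x y z : Fin 3} → x ≢ y → x ≢ z → y ≢ z → ∀ k → k ≡ x ⊎ k ≡ y ⊎ k ≡ z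
Fin3-cover {x} {y} {z} x≢y x≢z y≢z k with Fin.pigeonhole (ℕ.n<1+n 3) (x ∷ y ∷ z ∷ k ∷ [])
... | fzero , fsuc fzero , _ , x≡y = ⊥-elim (x≢y x≡y)
... | fzero , fsuc (fsuc fzero) , _ , x≡z = ⊥-elim (x≢z x≡z)
... | fzero , fsuc (fsuc (fsuc fzero)) , _ , x≡k = inj₁ (sym x≡k)
... | fsuc fzero , fsuc (fsuc fzero) , _ , y≡z = ⊥-elim (y≢z y≡z)
... | fsuc fzero , fsuc (fsuc (fsuc fzero)) , _ , y≡k = inj₂ (inj₁ (sym y≡k))
... | fsuc (fsuc fzero) , fsuc (fsuc (fsuc fzero)) , _ , z≡k = inj₂ (inj₂ (sym z≡k))
... | fsuc fzero , fsuc fzero , ℕ.s≤s () , _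
... | fsuc (fsuc _) , fsuc fzero , ℕ.s≤s () , _
... | fsuc (fsuc _) , fsuc (fsuc fzero) , ℕ.s≤s (ℕ.s≤s ()) , _
... | fsuc (fsuc (fsuc _)) , fsuc (fsuc (fsuc fzero)) , ℕ.s≤s (ℕ.s≤s (ℕ.s≤s ())) , _

Fin3-injective : ∀ {x y z : Fin 3} → x ≢ y → x ≢ z → y ≢ z →
                 ∀ i j → (x ∷ y ∷ z ∷ []) i ≡ (x ∷ y ∷ z ∷ []) j → i ≡ j
Fin3-injective x≢y x≢z y≢z fzero fzero _ = refl
Fin3-injective x≢y x≢z y≢z fzero (fsuc fzero) x≡y = ⊥-elim (x≢y x≡y)
Fin3-injective x≢y x≢z y≢z fzero (fsuc (fsuc fzero)) x≡z = ⊥-elim (x≢z x≡z)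
Fin3-injective x≢y x≢z y≢z (fsuc fzero) fzero y≡x = ⊥-elim (x≢y (sym y≡x))
Fin3-injective x≢y x≢z y≢z (fsuc fzero) (fsuc fzero) _ = refl
Fin3-injective x≢y x≢z y≢z (fsuc fzero) (fsuc (fsuc fzero)) y≡z = ⊥-elim (y≢z y≡z)
Fin3-injective x≢y x≢z y≢z (fsuc (fsuc fzero)) fzero z≡x = ⊥-elim (x≢z (sym z≡x))
Fin3-injective x≢y x≢z y≢z (fsuc (fsuc fzero)) (fsuc fzero) z≡y = ⊥-elim (y≢z (sym z≡y))
Fin3-injective x≢y x≢z y≢z (fsuc (fsuc fzero)) (fsuc (fsuc fzero)) _ = refl

opposite⇒≢ : ∀ {x y β : Bool} → x ≡ β → y ≡ not β → x ≢ y
opposite⇒≢ refl y≡notβ refl = not-¬ refl y≡notβ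

module ThreeAnchors (R : RealField) {n} {f : (Fin n → Bool) → Bool} (I : ThreeIntervals f)
  (not-extreme : 0 ℕ.< ThreeIntervals.a I ⊎ ThreeIntervals.b I ℕ.< n)
  (anchor : Fin 3 → Point R n) (label : Fin 3 → Bool)
  (nearest : ∀ X → ∃ λ i → label i ≡ f X × (∀ j → label j ≢ f X → Closer R X (anchor i) (anchor j))) where
  open ThreeIntervals I
  open RealField R
  open RealFieldProperties R
  open BandArguments R

  d : Fin 3 → (Fin n → Bool) → Carrier
  d k X = dist² R X (anchor k)

  winner : (Fin n → Bool) → Fin 3
  winner X = proj₁ (nearest X)

  winner-label : ∀ X → label (winner X) ≡ f X
  winner-label X = proj₁ (proj₂ (nearest X))

  winner-beats : ∀ X {j} → label j ≢ f X → d (winner X) X < d j X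
  winner-beats X {j} = proj₂ (proj₂ (nearest X)) j

  label-winner : ∀ {X k} → winner X ≡ k → label k ≡ f X
  label-winner {X} w≡k = trans (cong label (sym w≡k)) (winner-label X)

  winner-is : ∀ {X p j} → winner X ≡ p → label j ≢ f X → d p X < d j X
  winner-is {X} {j = j} w≡p = subst (λ w → d w X < d j X) w≡p ∘ winner-beats X

  f-outside : ∀ X → weight X ℕ.≤ a ⊎ b ℕ.≤ weight X → f X ≡ v
  f-outside X = [ f-below X , f-above X ]′

  p₀ q p₂ : Fin 3
  p₀ = winner (ones 0)
  q = winner (ones (suc a))
  p₂ = winner (ones n)

  ones-0-below : weight (ones {n} 0) ℕ.≤ a
  ones-0-below = ℕ.≤-trans (ℕ.≤-reflexive (weight-ones {n} 0 ℕ.z≤n)) ℕ.z≤n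

  ones-n-above : b ℕ.≤ weight (ones {n} n)
  ones-n-above = ℕ.≤-trans b≤n (ℕ.≤-reflexive (sym (weight-ones n ℕ.≤-refl)))

  label-p₀ : label p₀ ≡ v
  label-p₀ = trans (winner-label (ones 0)) (f-below (ones 0) ones-0-below)

  label-p₂ : label p₂ ≡ v
  label-p₂ = trans (winner-label (ones n)) (f-above (ones n) ones-n-above)

  label-q : label q ≡ not v
  label-q = trans (winner-label (ones (suc a)))
                  (f-inside (ones (suc a)) (ℕ.≤-reflexive (sym 1+a≡)) (ℕ.<-≤-trans (ℕ.≤-reflexive (cong suc 1+a≡)) a+2≤b))
    where
    1+a≡ : weight (ones {n} (suc a)) ≡ suc a
    1+a≡ = weight-ones (suc a) (ℕ.≤-trans (ℕ.n≤1+n _) (ℕ.≤-trans a+2≤b b≤n))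

  opposite-labels : ∀ {j k} → label j ≡ v → label k ≡ not v → j ≢ k
  opposite-labels label-j label-k refl = opposite⇒≢ label-j label-k refl

  q-loses-outside : ∀ X → weight X ℕ.≤ a ⊎ b ℕ.≤ weight X → label q ≢ f X
  q-loses-outside X out = opposite⇒≢ (f-outside X out) label-q ∘ sym

  only-q-opposes : ∀ k → label k ≡ not v → k ≡ q
  only-q-opposes k label-k with k Fin.≟ q
  ... | yes k≡q = k≡q
  ... | no k≢q = ⊥-elim (one-versus-two-impossible (dist²-swapAdditive (anchor p₀)) (dist²-swapAdditive (anchor q))
                           (dist²-swapAdditive (anchor k)) a+2≤b b≤n not-extreme outside inside)
    where
    cover = Fin3-cover (opposite-labels label-p₀ label-q) (opposite-labels label-p₀ label-k) (k≢q ∘ sym)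
    outside : ∀ S → weight S ℕ.≤ a ⊎ b ℕ.≤ weight S → d p₀ S < d q S × d p₀ S < d k S
    outside S out with cover (winner S)
    ... | inj₁ w≡p₀ = winner-is w≡p₀ (q-loses-outside S out) ,
                      winner-is w≡p₀ (opposite⇒≢ (f-outside S out) label-k ∘ sym)
    ... | inj₂ (inj₁ w≡q) = ⊥-elim (opposite⇒≢ (f-outside S out) label-q (sym (label-winner w≡q)))
    ... | inj₂ (inj₂ w≡k) = ⊥-elim (opposite⇒≢ (f-outside S out) label-k (sym (label-winner w≡k)))
    inside : ∀ S → a ℕ.< weight S → weight S ℕ.< b → d q S < d p₀ S ⊎ d k S < d p₀ S
    inside S a<S S<b with cover (winner S)
    ... | inj₁ w≡p₀ = ⊥-elim (opposite⇒≢ label-p₀ (f-inside S a<S S<b) (label-winner w≡p₀))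
    ... | inj₂ (inj₁ w≡q) = inj₁ (winner-is w≡q (opposite⇒≢ label-p₀ (f-inside S a<S S<b)))
    ... | inj₂ (inj₂ w≡k) = inj₂ (winner-is w≡k (opposite⇒≢ label-p₀ (f-inside S a<S S<b)))

  q-wins-inside : ∀ X → a ℕ.< weight X → weight X ℕ.< b → ∀ k → k ≢ q → d q X < d k X
  q-wins-inside X a<X X<b k k≢q =
    winner-is (only-q-opposes (winner X) (trans (winner-label X) f≡))
              (λ label-k → k≢q (only-q-opposes k (trans label-k f≡)))
    where
    f≡ = f-inside X a<X X<b

  beats-q-on-one-side-only : ∀ p → p ≢ q → ∀ {X Z} → weight X ℕ.≤ a → b ℕ.≤ weight Z →
                             d p X < d q X → d p Z < d q Z → ⊥
  beats-q-on-one-side-only p p≢q =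
    ¬-below-and-above-band (dist²-swapAdditive (anchor p)) (dist²-swapAdditive (anchor q)) a+2≤b
                           (λ S a<S S<b → q-wins-inside S a<S S<b p p≢q)

  p₀≢q : p₀ ≢ q
  p₀≢q = opposite-labels label-p₀ label-q

  p₂≢q : p₂ ≢ q
  p₂≢q = opposite-labels label-p₂ label-q

  p₀-beats-q : d p₀ (ones 0) < d q (ones 0)
  p₀-beats-q = winner-beats (ones 0) (q-loses-outside (ones 0) (inj₁ ones-0-below))

  p₂-beats-q : d p₂ (ones n) < d q (ones n)
  p₂-beats-q = winner-beats (ones n) (q-loses-outside (ones n) (inj₂ ones-n-above))

  p₀≢p₂ : p₀ ≢ p₂
  p₀≢p₂ p₀≡p₂ = beats-q-on-one-side-only p₀ p₀≢q ones-0-below ones-n-above p₀-beats-q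
                  (subst (λ p → d p (ones n) < d q (ones n)) (sym p₀≡p₂) p₂-beats-q)

  cover : ∀ k → k ≡ p₀ ⊎ k ≡ q ⊎ k ≡ p₂
  cover = Fin3-cover p₀≢q p₀≢p₂ (p₂≢q ∘ sym)

  p₀-or-p₂-beats-q : ∀ X → weight X ℕ.≤ a ⊎ b ℕ.≤ weight X → d p₀ X < d q X ⊎ d p₂ X < d q X
  p₀-or-p₂-beats-q X out with cover (winner X)
  ... | inj₁ w≡p₀ = inj₁ (winner-is w≡p₀ (q-loses-outside X out))
  ... | inj₂ (inj₁ w≡q) = ⊥-elim (opposite⇒≢ (f-outside X out) label-q (sym (label-winner w≡q)))
  ... | inj₂ (inj₂ w≡p₂) = inj₂ (winner-is w≡p₂ (q-loses-outside X out))

  closest-of-three : ∀ {X p p′} → (∀ k → k ≡ p ⊎ k ≡ q ⊎ k ≡ p′) →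
                     d p X < d q X → ¬ (d p′ X < d q X) → ∀ k → k ≢ p → d p X < d k X
  closest-of-three {X} {p} {p′} cover′ p<q p′≮q k k≢p with cover′ k
  ... | inj₁ k≡p = ⊥-elim (k≢p k≡p)
  ... | inj₂ (inj₁ refl) = p<q
  ... | inj₂ (inj₂ refl) = <-≤-trans p<q (≮⇒≥ p′≮q)

  p₀-wins-below : ∀ X → weight X ℕ.≤ a → ∀ k → k ≢ p₀ → d p₀ X < d k X
  p₀-wins-below X X≤a = closest-of-three {X} cover p₀<q p₂≮q
    where
    p₂≮q : ¬ (d p₂ X < d q X)
    p₂≮q p₂<q = beats-q-on-one-side-only p₂ p₂≢q X≤a ones-n-above p₂<q p₂-beats-q
    p₀<q = [ id , ⊥-elim ∘ p₂≮q ]′ (p₀-or-p₂-beats-q X (inj₁ X≤a))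

  p₂-wins-above : ∀ X → b ℕ.≤ weight X → ∀ k → k ≢ p₂ → d p₂ X < d k X
  p₂-wins-above X b≤X = closest-of-three {X} (Fin3-cover p₂≢q (p₀≢p₂ ∘ sym) (p₀≢q ∘ sym)) p₂<q p₀≮q
    where
    p₀≮q : ¬ (d p₀ X < d q X)
    p₀≮q p₀<q = beats-q-on-one-side-only p₀ p₀≢q ones-0-below b≤X p₀-beats-q p₀<q
    p₂<q = [ ⊥-elim ∘ p₀≮q , id ]′ (p₀-or-p₂-beats-q X (inj₂ b≤X))

  σ : Fin 3 → Fin 3
  σ = p₀ ∷ q ∷ p₂ ∷ []

  σ-injective : ∀ i j → σ i ≡ σ j → i ≡ j
  σ-injective = Fin3-injective p₀≢q p₀≢p₂ (p₂≢q ∘ sym)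

  σ-wins : ∀ X i → Interval a b i (weight X) → ∀ k → k ≢ σ i → d (σ i) X < d k X
  σ-wins X fzero = p₀-wins-below X
  σ-wins X (fsuc fzero) (a<X , X<b) = q-wins-inside X a<X X<b
  σ-wins X (fsuc (fsuc fzero)) = p₂-wins-above X

lemma3 : (R : RealField) (n : ℕ) (f : (Fin n → Bool) → Bool) →
    Symmetric f →
    numIntervals f ≡ 3 →
    ¬ (∀ X → f X ≡ atEnds X) →
    ¬ (∀ X → f X ≡ not (atEnds X)) →
    (a : Fin 3 → Point R n) (lab : Fin 3 → Bool) →
    IsNNRep R f a lab →
    Σ (Fin 3 → Fin 3) λ σ →
      (∀ i j → σ i ≡ σ j → i ≡ j) ×
      (∀ X (i : Fin 3) → toℕ i ≡ intervalIndex f (weight X) →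
        ∀ k → k ≢ σ i → Closer R X (a (σ i)) (a k))
lemma3 R n f symmetric three ¬ends ¬co-ends anchor label (_ , nearest) =
  σ , σ-injective , λ X i i≡index → σ-wins X i (interval X i i≡index)
  where
  I = three-intervals symmetric three
  open ThreeIntervals I using (interval)
  open ThreeAnchors R I (cut-points-not-extreme I ¬ends ¬co-ends) anchor label nearest
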